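{- Let $\mathbb{Z}_{\langle 2\rangle}=\{p/q: p\in\mathbb{Z},\ q \text{ an odd integer}\}\subseteq\mathbb{Q}$. Let $P\subseteq\mathbb{R}^d$ be a convex polytope specified by $Ax\le B$ and $x_i\ge 0$ for all $i$, where $A$ and $B$ are integral, and let $\mathrm{Aff}(P)$ denote its affine span. Then $P$ contains a point of $\mathbb{Z}_{\langle 2\rangle}^d$ if and only if $\mathrm{Aff}(P)$ contains a point of $\mathbb{Z}_{\langle 2\rangle}^d$.
   Context: $\mathbb{Z}_{\langle 2\rangle}$ is the localization of $\mathbb{Z}$ at the prime $2$, i.e. the ring of rationals with odd denominators.
   Formalization: Stated over ℚ^d rather than ℝ^d: the polytope P is represented by its rational points, and $\mathrm{Aff}(P)$ by rational affine combinations of those points. -}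

module Defs where

open import Data.Nat using (ℕ; zero; suc)
open import Data.Nat.Divisibility using (_∣_)
open import Data.Integer using (ℤ; +_)
open import Data.Rational using (ℚ; _/_; _+_; _*_; _≤_; 0ℚ; 1ℚ)
open import Data.Fin using (Fin; zero; suc)
open import Data.Product using (Σ; _×_)
open import Relation.Nullary using (¬_)
open import Relation.Binary.PropositionalEquality using (_≡_)

ℤ→ℚ : ℤ → ℚ
ℤ→ℚ z = z / 1

∑ : (n : ℕ) → (Fin n → ℚ) → ℚ
∑ zero    f = 0ℚ
∑ (suc n) f = f zero + ∑ n (λ i → f (suc i))

Point : ℕ → Set
Point d = Fin d → ℚ

-- ℤ_⟨2⟩ = { p / q : p ∈ ℤ, q an odd integer }  (q taken positive w.l.o.g.)
Z₂ : ℚ → Set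
Z₂ x = Σ ℤ λ p → Σ ℕ λ q → (¬ (2 ∣ q)) × (x * ℤ→ℚ (+ q) ≡ ℤ→ℚ p)

Z₂Point : (d : ℕ) → Point d → Set
Z₂Point d x = (i : Fin d) → Z₂ (x i)

InP : (m d : ℕ) → (Fin m → Fin d → ℤ) → (Fin m → ℤ) → Point d → Set
InP m d A B x =
  ((j : Fin m) → ∑ d (λ i → ℤ→ℚ (A j i) * x i) ≤ ℤ→ℚ (B j))
  × ((i : Fin d) → 0ℚ ≤ x i)

Bounded : (m d : ℕ) → (Fin m → Fin d → ℤ) → (Fin m → ℤ) → Set
Bounded m d A B = Σ ℚ λ M → (x : Point d) → InP m d A B x → (i : Fin d) → x i ≤ M

InAff : (m d : ℕ) → (Fin m → Fin d → ℤ) → (Fin m → ℤ) → Point d → Set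
InAff m d A B x =
  Σ ℕ λ k → Σ (Fin k → Point d) λ p → Σ (Fin k → ℚ) λ c →
    ((l : Fin k) → InP m d A B (p l))
    × (∑ k c ≡ 1ℚ)
    × ((i : Fin d) → x i ≡ ∑ k (λ l → c l * p l i))

{-# OPTIONS --safe #-}
-- Let x = Σ c_l p_l with Σ c_l = 1 be an affine combination of points p_l of P
-- with x ∈ ℤ_⟨2⟩^d.  For s ∈ ℕ put K = 1 + k s and
--   y = Σ (c_l + s)/K · p_l = (x + s Σ p_l)/K.
-- The weights (c_l + s)/K sum to 1 and are non-negative once s ≥ −c_l, so y ∈ P
-- by convexity.  Taking s even and a multiple of a common denominator of Σ p_l
-- makes s Σ p_l integral and K odd, so y ∈ ℤ_⟨2⟩^d because ℤ_⟨2⟩ is a subring of ℚ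
-- containing 1/K.
module Submission where

open import Defs
open import Algebra.Bundles using (CommutativeRing)
open import Data.Nat as ℕ using (ℕ; zero; suc; NonZero)
import Data.Nat.Properties as ℕP
open import Data.Nat.Coprimality as Coprime using (1-coprimeTo)
open import Data.Nat.Divisibility
  using (_∣_; ∣1⇒≡1; ∣m+n∣m⇒∣n; ∣-trans; m∣m*n; n∣m*n)
open import Data.Nat.Primality using (prime?; euclidsLemma)
open import Data.Integer as ℤ using (ℤ; +_; -[1+_])
import Data.Integer.Properties as ℤP
open import Data.Rational as ℚ
  using (ℚ; mkℚ; _+_; _*_; -_; 1/_; _≤_; 0ℚ; 1ℚ; ↥_; ↧ₙ_; *≤*)
import Data.Rational.Properties as ℚP
import Data.Rational.Unnormalised as ℚᵘ
import Data.Rational.Unnormalised.Properties as ℚᵘP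
open import Data.Rational.Solver using (module +-*-Solver)
open import Data.Fin using (Fin; zero; suc)
open import Data.Product using (Σ; _×_; _,_; proj₁; proj₂)
open import Data.Sum using (inj₁; inj₂)
open import Function.Base using (_∘_)
open import Function.Bundles using (_⇔_; mk⇔)
open import Relation.Nullary using (¬_)
open import Relation.Nullary.Decidable using (from-yes)
open import Relation.Binary.PropositionalEquality
  using (_≡_; refl; sym; trans; cong; cong₂; subst; subst₂; module ≡-Reasoning)
import Algebra.Properties.Semiring.Sum as SemiringSum

open +-*-Solver

ℤ→ℚ≡mkℚ : ∀ z → ℤ→ℚ z ≡ mkℚ z 0 (Coprime.sym (1-coprimeTo _))
ℤ→ℚ≡mkℚ z = ℚP.↥p/↧p≡p (mkℚ z 0 (Coprime.sym (1-coprimeTo _)))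

ℤ→ℚ-homo-* : ∀ a b → ℤ→ℚ (a ℤ.* b) ≡ ℤ→ℚ a * ℤ→ℚ b
ℤ→ℚ-homo-* a b rewrite ℤ→ℚ≡mkℚ a | ℤ→ℚ≡mkℚ b = refl

ℤ→ℚ-homo-+ : ∀ a b → ℤ→ℚ (a ℤ.+ b) ≡ ℤ→ℚ a + ℤ→ℚ b
ℤ→ℚ-homo-+ a b rewrite ℤ→ℚ≡mkℚ a | ℤ→ℚ≡mkℚ b | ℤP.*-identityʳ a | ℤP.*-identityʳ b = refl

ℤ→ℚ-mono-≤ : ∀ {a b} → a ℤ.≤ b → ℤ→ℚ a ≤ ℤ→ℚ b
ℤ→ℚ-mono-≤ {a} {b} a≤b rewrite ℤ→ℚ≡mkℚ a | ℤ→ℚ≡mkℚ b =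
  *≤* (subst₂ ℤ._≤_ (sym (ℤP.*-identityʳ a)) (sym (ℤP.*-identityʳ b)) a≤b)

ℤ→ℚ-pos-* : ∀ m n → ℤ→ℚ (+ (m ℕ.* n)) ≡ ℤ→ℚ (+ m) * ℤ→ℚ (+ n)
ℤ→ℚ-pos-* m n = trans (cong ℤ→ℚ (ℤP.pos-* m n)) (ℤ→ℚ-homo-* (+ m) (+ n))

ℤ→ℚ-pos-mono-≤ : ∀ {m n} → m ℕ.≤ n → ℤ→ℚ (+ m) ≤ ℤ→ℚ (+ n)
ℤ→ℚ-pos-mono-≤ m≤n = ℤ→ℚ-mono-≤ (ℤ.+≤+ m≤n)

ℤ→ℚ-suc-positive : ∀ n → ℚ.Positive (ℤ→ℚ (+ suc n))
ℤ→ℚ-suc-positive n = subst ℚ.Positive (sym (ℤ→ℚ≡mkℚ (+ suc n))) _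

*-denominator : ∀ r → r * ℤ→ℚ (+ ↧ₙ r) ≡ ℤ→ℚ (↥ r)
*-denominator r@(mkℚ n d _) rewrite ℤ→ℚ≡mkℚ (+ suc d) | ℤ→ℚ≡mkℚ n =
  ℚP.toℚᵘ-injective (ℚᵘP.≃-trans (ℚP.toℚᵘ-homo-* r (mkℚ (+ suc d) 0 (Coprime.sym (1-coprimeTo _))))
                                  (ℚᵘ.*≡* (ℤP.*-assoc n (+ suc d) (+ 1))))

ℕ-upperBound : ∀ r → Σ ℕ λ N → r ≤ ℤ→ℚ (+ N)
ℕ-upperBound r@(mkℚ (+ a) d _) = a , subst (r ≤_) (sym (ℤ→ℚ≡mkℚ (+ a)))
  (*≤* (ℤP.*-monoˡ-≤-nonNeg (+ a) (ℤ.+≤+ (ℕ.s≤s ℕ.z≤n))))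
ℕ-upperBound r@(mkℚ -[1+ a ] d _) = 0 , ℚP.<⇒≤ (ℚP.negative⁻¹ r)

ℕ-uniformUpperBound : ∀ k (f : Fin k → ℚ) → Σ ℕ λ N → ∀ l → f l ≤ ℤ→ℚ (+ N)
ℕ-uniformUpperBound zero    f = 0 , λ ()
ℕ-uniformUpperBound (suc k) f with ℕ-upperBound (f zero) | ℕ-uniformUpperBound k (f ∘ suc)
... | N₀ , f₀≤N₀ | N , f≤N = N₀ ℕ.⊔ N , λ where
  zero    → ℚP.≤-trans f₀≤N₀ (ℤ→ℚ-pos-mono-≤ (ℕP.m≤m⊔n N₀ N))
  (suc l) → ℚP.≤-trans (f≤N l) (ℤ→ℚ-pos-mono-≤ (ℕP.m≤n⊔m N₀ N))

*-nonNeg : ∀ {p q} → 0ℚ ≤ p → 0ℚ ≤ q → 0ℚ ≤ p * q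
*-nonNeg {p} {q} 0≤p 0≤q = ℚP.nonNegative⁻¹ (p * q)
  {{ℚP.nonNeg*nonNeg⇒nonNeg p {{ℚ.nonNegative 0≤p}} q {{ℚ.nonNegative 0≤q}}}}

module ℚΣ = SemiringSum (CommutativeRing.semiring ℚP.+-*-commutativeRing)

∑≡sum : ∀ n (f : Fin n → ℚ) → ∑ n f ≡ ℚΣ.sum f
∑≡sum zero    f = refl
∑≡sum (suc n) f = cong (λ t → f zero + t) (∑≡sum n (f ∘ suc))

∑-cong : ∀ n {f g : Fin n → ℚ} → (∀ i → f i ≡ g i) → ∑ n f ≡ ∑ n g
∑-cong zero    f≗g = refl
∑-cong (suc n) f≗g = cong₂ _+_ (f≗g zero) (∑-cong n (f≗g ∘ suc))

∑-distrib-+ : ∀ n (f g : Fin n → ℚ) → ∑ n (λ i → f i + g i) ≡ ∑ n f + ∑ n g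
∑-distrib-+ n f g = begin
  ∑ n (λ i → f i + g i)    ≡⟨ ∑≡sum n _ ⟩
  ℚΣ.sum (λ i → f i + g i) ≡⟨ ℚΣ.∑-distrib-+ f g ⟩
  ℚΣ.sum f + ℚΣ.sum g      ≡⟨ sym (cong₂ _+_ (∑≡sum n f) (∑≡sum n g)) ⟩
  ∑ n f + ∑ n g            ∎
  where open ≡-Reasoning

∑-comm : ∀ m n (f : Fin m → Fin n → ℚ) →
         ∑ m (λ i → ∑ n (f i)) ≡ ∑ n (λ j → ∑ m (λ i → f i j))
∑-comm m n f = begin
  ∑ m (λ i → ∑ n (f i))               ≡⟨ ∑-cong m (λ i → ∑≡sum n (f i)) ⟩
  ∑ m (λ i → ℚΣ.sum (f i))            ≡⟨ ∑≡sum m _ ⟩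
  ℚΣ.sum (λ i → ℚΣ.sum (f i))         ≡⟨ ℚΣ.∑-comm f ⟩
  ℚΣ.sum (λ j → ℚΣ.sum (λ i → f i j)) ≡⟨ sym (∑≡sum n _) ⟩
  ∑ n (λ j → ℚΣ.sum (λ i → f i j))    ≡⟨ sym (∑-cong n (λ j → ∑≡sum m (λ i → f i j))) ⟩
  ∑ n (λ j → ∑ m (λ i → f i j))       ∎
  where open ≡-Reasoning

*-distribˡ-∑ : ∀ n a (f : Fin n → ℚ) → a * ∑ n f ≡ ∑ n (λ i → a * f i)
*-distribˡ-∑ n a f = begin
  a * ∑ n f              ≡⟨ cong (a *_) (∑≡sum n f) ⟩
  a * ℚΣ.sum f           ≡⟨ ℚΣ.*-distribˡ-sum a f ⟩
  ℚΣ.sum (λ i → a * f i) ≡⟨ sym (∑≡sum n _) ⟩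
  ∑ n (λ i → a * f i)    ∎
  where open ≡-Reasoning

*-distribʳ-∑ : ∀ n a (f : Fin n → ℚ) → ∑ n f * a ≡ ∑ n (λ i → f i * a)
*-distribʳ-∑ n a f = begin
  ∑ n f * a              ≡⟨ cong (_* a) (∑≡sum n f) ⟩
  ℚΣ.sum f * a           ≡⟨ ℚΣ.*-distribʳ-sum a f ⟩
  ℚΣ.sum (λ i → f i * a) ≡⟨ sym (∑≡sum n _) ⟩
  ∑ n (λ i → f i * a)    ∎
  where open ≡-Reasoning

∑-const : ∀ n a → ∑ n (λ _ → a) ≡ ℤ→ℚ (+ n) * a
∑-const zero    a = sym (ℚP.*-zeroˡ a)
∑-const (suc n) a rewrite ∑-const n a | ℤ→ℚ-homo-+ (+ 1) (+ n) =
  solve 2 (λ a n → a :+ n :* a := (con 1ℚ :+ n) :* a) refl a (ℤ→ℚ (+ n))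

∑-mono-≤ : ∀ n {f g : Fin n → ℚ} → (∀ i → f i ≤ g i) → ∑ n f ≤ ∑ n g
∑-mono-≤ zero    f≤g = ℚP.≤-refl
∑-mono-≤ (suc n) f≤g = ℚP.+-mono-≤ (f≤g zero) (∑-mono-≤ n (f≤g ∘ suc))

∑-nonNeg : ∀ n {f : Fin n → ℚ} → (∀ i → 0ℚ ≤ f i) → 0ℚ ≤ ∑ n f
∑-nonNeg zero    0≤f = ℚP.≤-refl
∑-nonNeg (suc n) 0≤f = ℚP.+-mono-≤ (0≤f zero) (∑-nonNeg n (0≤f ∘ suc))

2∤1 : ¬ 2 ∣ 1
2∤1 2∣1 with ∣1⇒≡1 2∣1
... | ()

2∤suc : ∀ {m} → 2 ∣ m → ¬ 2 ∣ suc m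
2∤suc {m} 2∣m 2∣1+m = 2∤1 (∣m+n∣m⇒∣n (subst (2 ∣_) (ℕP.+-comm 1 m) 2∣1+m) 2∣m)

2∤* : ∀ {a b} → ¬ 2 ∣ a → ¬ 2 ∣ b → ¬ 2 ∣ a ℕ.* b
2∤* {a} {b} 2∤a 2∤b 2∣ab with euclidsLemma a b (from-yes (prime? 2)) 2∣ab
... | inj₁ 2∣a = 2∤a 2∣a
... | inj₂ 2∣b = 2∤b 2∣b

Z₂-ℤ : ∀ z → Z₂ (ℤ→ℚ z)
Z₂-ℤ z = z , 1 , 2∤1 , ℚP.*-identityʳ (ℤ→ℚ z)

Z₂-+ : ∀ {x y} → Z₂ x → Z₂ y → Z₂ (x + y)
Z₂-+ {x} {y} (p , q , 2∤q , xq≡p) (p′ , q′ , 2∤q′ , yq′≡p′) =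
  p ℤ.* + q′ ℤ.+ p′ ℤ.* + q , q ℕ.* q′ , 2∤* 2∤q 2∤q′ , (begin
    (x + y) * ℤ→ℚ (+ (q ℕ.* q′))        ≡⟨ cong ((x + y) *_) (ℤ→ℚ-pos-* q q′) ⟩
    (x + y) * (Q * Q′)                  ≡⟨ solve 4 (λ x y Q Q′ → (x :+ y) :* (Q :* Q′) := x :* Q :* Q′ :+ y :* Q′ :* Q) refl x y Q Q′ ⟩
    x * Q * Q′ + y * Q′ * Q             ≡⟨ cong₂ (λ a b → a * Q′ + b * Q) xq≡p yq′≡p′ ⟩
    ℤ→ℚ p * Q′ + ℤ→ℚ p′ * Q             ≡⟨ sym (cong₂ _+_ (ℤ→ℚ-homo-* p (+ q′)) (ℤ→ℚ-homo-* p′ (+ q))) ⟩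
    ℤ→ℚ (p ℤ.* + q′) + ℤ→ℚ (p′ ℤ.* + q) ≡⟨ sym (ℤ→ℚ-homo-+ (p ℤ.* + q′) (p′ ℤ.* + q)) ⟩
    ℤ→ℚ (p ℤ.* + q′ ℤ.+ p′ ℤ.* + q)     ∎)
  where
  open ≡-Reasoning
  Q  = ℤ→ℚ (+ q)
  Q′ = ℤ→ℚ (+ q′)

Z₂-* : ∀ {x y} → Z₂ x → Z₂ y → Z₂ (x * y)
Z₂-* {x} {y} (p , q , 2∤q , xq≡p) (p′ , q′ , 2∤q′ , yq′≡p′) =
  p ℤ.* p′ , q ℕ.* q′ , 2∤* 2∤q 2∤q′ , (begin
    x * y * ℤ→ℚ (+ (q ℕ.* q′))  ≡⟨ cong (x * y *_) (ℤ→ℚ-pos-* q q′) ⟩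
    x * y * (Q * Q′)            ≡⟨ solve 4 (λ x y Q Q′ → x :* y :* (Q :* Q′) := x :* Q :* (y :* Q′)) refl x y Q Q′ ⟩
    x * Q * (y * Q′)            ≡⟨ cong₂ _*_ xq≡p yq′≡p′ ⟩
    ℤ→ℚ p * ℤ→ℚ p′              ≡⟨ sym (ℤ→ℚ-homo-* p p′) ⟩
    ℤ→ℚ (p ℤ.* p′)              ∎)
  where
  open ≡-Reasoning
  Q  = ℤ→ℚ (+ q)
  Q′ = ℤ→ℚ (+ q′)

Z₂-inverse-odd : ∀ {x q} → ¬ 2 ∣ q → x * ℤ→ℚ (+ q) ≡ 1ℚ → Z₂ x
Z₂-inverse-odd {q = q} 2∤q xq≡1 = + 1 , q , 2∤q , xq≡1

denominators : ∀ n → (Fin n → ℚ) → ℕ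
denominators zero    f = 1
denominators (suc n) f = ↧ₙ f zero ℕ.* denominators n (f ∘ suc)

denominators-nonZero : ∀ n f → NonZero (denominators n f)
denominators-nonZero zero    f = _
denominators-nonZero (suc n) f =
  ℕP.m*n≢0 (↧ₙ f zero) _ {{_}} {{denominators-nonZero n (f ∘ suc)}}

*-denominators-integral : ∀ n f i → Σ ℤ λ z → f i * ℤ→ℚ (+ denominators n f) ≡ ℤ→ℚ z
*-denominators-integral (suc n) f zero = ↥ f zero ℤ.* + D , (begin
  f zero * ℤ→ℚ (+ (↧ₙ f zero ℕ.* D))    ≡⟨ cong (f zero *_) (ℤ→ℚ-pos-* (↧ₙ f zero) D) ⟩
  f zero * (ℤ→ℚ (+ ↧ₙ f zero) * D′)     ≡⟨ sym (ℚP.*-assoc (f zero) _ D′) ⟩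
  f zero * ℤ→ℚ (+ ↧ₙ f zero) * D′       ≡⟨ cong (_* D′) (*-denominator (f zero)) ⟩
  ℤ→ℚ (↥ f zero) * D′                   ≡⟨ sym (ℤ→ℚ-homo-* (↥ f zero) (+ D)) ⟩
  ℤ→ℚ (↥ f zero ℤ.* + D)                ∎)
  where
  open ≡-Reasoning
  D  = denominators n (f ∘ suc)
  D′ = ℤ→ℚ (+ D)
*-denominators-integral (suc n) f (suc i) with *-denominators-integral n (f ∘ suc) i
... | z , fD≡z = z ℤ.* + ↧ₙ f zero , (begin
  f (suc i) * ℤ→ℚ (+ (↧ₙ f zero ℕ.* D)) ≡⟨ cong (f (suc i) *_) (ℤ→ℚ-pos-* (↧ₙ f zero) D) ⟩
  f (suc i) * (E * D′)                  ≡⟨ solve 3 (λ a e d → a :* (e :* d) := a :* d :* e) refl (f (suc i)) E D′ ⟩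
  f (suc i) * D′ * E                    ≡⟨ cong (_* E) fD≡z ⟩
  ℤ→ℚ z * E                             ≡⟨ sym (ℤ→ℚ-homo-* z (+ ↧ₙ f zero)) ⟩
  ℤ→ℚ (z ℤ.* + ↧ₙ f zero)               ∎)
  where
  open ≡-Reasoning
  D  = denominators n (f ∘ suc)
  D′ = ℤ→ℚ (+ D)
  E  = ℤ→ℚ (+ ↧ₙ f zero)

combination : ∀ {k d} → (Fin k → Point d) → (Fin k → ℚ) → Point d
combination {k} p c i = ∑ k (λ l → c l * p l i)

InP-convex : ∀ {m d k} A B (p : Fin k → Point d) (μ : Fin k → ℚ) →
             (∀ l → InP m d A B (p l)) → (∀ l → 0ℚ ≤ μ l) → ∑ k μ ≡ 1ℚ →
             InP m d A B (combination p μ)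
InP-convex {m} {d} {k} A B p μ p∈P 0≤μ ∑μ≡1 = rows , coordinates
  where
  coordinates : ∀ i → 0ℚ ≤ combination p μ i
  coordinates i = ∑-nonNeg k (λ l → *-nonNeg (0≤μ l) (proj₂ (p∈P l) i))

  rows : ∀ j → ∑ d (λ i → ℤ→ℚ (A j i) * combination p μ i) ≤ ℤ→ℚ (B j)
  rows j = begin
    ∑ d (λ i → a i * ∑ k (λ l → μ l * p l i))   ≡⟨ ∑-cong d (λ i → *-distribˡ-∑ k (a i) _) ⟩
    ∑ d (λ i → ∑ k (λ l → a i * (μ l * p l i))) ≡⟨ ∑-comm d k _ ⟩
    ∑ k (λ l → ∑ d (λ i → a i * (μ l * p l i))) ≡⟨ ∑-cong k (λ l → trans (∑-cong d (λ i → exchange (a i) (μ l) (p l i)))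
                                                                     (sym (*-distribˡ-∑ d (μ l) _))) ⟩
    ∑ k (λ l → μ l * ∑ d (λ i → a i * p l i))   ≤⟨ ∑-mono-≤ k (λ l → ℚP.*-monoˡ-≤-nonNeg (μ l) {{ℚ.nonNegative (0≤μ l)}}
                                                                     (proj₁ (p∈P l) j)) ⟩
    ∑ k (λ l → μ l * b)                         ≡⟨ sym (*-distribʳ-∑ k b μ) ⟩
    ∑ k μ * b                                   ≡⟨ cong (_* b) ∑μ≡1 ⟩
    1ℚ * b                                      ≡⟨ ℚP.*-identityˡ b ⟩
    b                                           ∎
    where
    open ℚP.≤-Reasoning
    a : Fin d → ℚ
    a i = ℤ→ℚ (A j i)
    b : ℚ
    b = ℤ→ℚ (B j)
    exchange : ∀ x y z → x * (y * z) ≡ y * (x * z)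
    exchange = solve 3 (λ x y z → x :* (y :* z) := y :* (x :* z)) refl

module ShiftedWeights {d k} (p : Fin k → Point d) (c : Fin k → ℚ) (s : ℕ) where

  s′ : ℚ
  s′ = ℤ→ℚ (+ s)

  K : ℕ
  K = suc (k ℕ.* s)

  K′ : ℚ
  K′ = ℤ→ℚ (+ K)

  instance
    K′-positive : ℚ.Positive K′
    K′-positive = ℤ→ℚ-suc-positive (k ℕ.* s)

    K′-nonZero : ℚ.NonZero K′
    K′-nonZero = ℚP.pos⇒nonZero K′

  shifted : Fin k → ℚ
  shifted l = 1/ K′ * (c l + s′)

  shifted-nonNeg : (∀ l → - c l ≤ s′) → ∀ l → 0ℚ ≤ shifted l
  shifted-nonNeg -c≤s l = *-nonNeg 1/K′-nonNeg (begin
    0ℚ          ≡⟨ sym (ℚP.+-inverseʳ (c l)) ⟩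
    c l + - c l ≤⟨ ℚP.+-monoʳ-≤ (c l) (-c≤s l) ⟩
    c l + s′    ∎)
    where
    open ℚP.≤-Reasoning
    1/K′-nonNeg : 0ℚ ≤ 1/ K′
    1/K′-nonNeg = ℚP.<⇒≤ (ℚP.positive⁻¹ (1/ K′) {{ℚP.1/pos⇒pos K′}})

  ∑-shifted : ∑ k c ≡ 1ℚ → ∑ k shifted ≡ 1ℚ
  ∑-shifted ∑c≡1 = begin
    ∑ k shifted                      ≡⟨ sym (*-distribˡ-∑ k (1/ K′) _) ⟩
    1/ K′ * ∑ k (λ l → c l + s′)     ≡⟨ cong (1/ K′ *_) ∑c+s≡K ⟩
    1/ K′ * K′                       ≡⟨ ℚP.*-inverseˡ K′ ⟩
    1ℚ                               ∎
    where
    open ≡-Reasoning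
    ∑c+s≡K : ∑ k (λ l → c l + s′) ≡ K′
    ∑c+s≡K = begin
      ∑ k (λ l → c l + s′)           ≡⟨ ∑-distrib-+ k c (λ _ → s′) ⟩
      ∑ k c + ∑ k (λ _ → s′)         ≡⟨ cong₂ _+_ ∑c≡1 (∑-const k s′) ⟩
      1ℚ + ℤ→ℚ (+ k) * s′            ≡⟨ cong (λ t → 1ℚ + t) (sym (ℤ→ℚ-pos-* k s)) ⟩
      ℤ→ℚ (+ 1) + ℤ→ℚ (+ (k ℕ.* s))  ≡⟨ sym (ℤ→ℚ-homo-+ (+ 1) (+ (k ℕ.* s))) ⟩
      K′                             ∎

  combination-shifted : ∀ i →
    combination p shifted i ≡ 1/ K′ * (combination p c i + s′ * ∑ k (λ l → p l i))
  combination-shifted i = begin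
    ∑ k (λ l → 1/ K′ * (c l + s′) * p l i)                    ≡⟨ ∑-cong k (λ l → ℚP.*-assoc (1/ K′) _ (p l i)) ⟩
    ∑ k (λ l → 1/ K′ * ((c l + s′) * p l i))                  ≡⟨ sym (*-distribˡ-∑ k (1/ K′) _) ⟩
    1/ K′ * ∑ k (λ l → (c l + s′) * p l i)                    ≡⟨ cong (1/ K′ *_) (∑-cong k (λ l → ℚP.*-distribʳ-+ (p l i) (c l) s′)) ⟩
    1/ K′ * ∑ k (λ l → c l * p l i + s′ * p l i)              ≡⟨ cong (1/ K′ *_) (∑-distrib-+ k _ _) ⟩
    1/ K′ * (combination p c i + ∑ k (λ l → s′ * p l i))      ≡⟨ cong (λ t → 1/ K′ * (combination p c i + t)) (sym (*-distribˡ-∑ k s′ _)) ⟩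
    1/ K′ * (combination p c i + s′ * ∑ k (λ l → p l i))      ∎
    where open ≡-Reasoning

  Z₂-combination-shifted : 2 ∣ s → (∀ i → Z₂ (s′ * ∑ k (λ l → p l i))) →
                           Z₂Point d (combination p c) → Z₂Point d (combination p shifted)
  Z₂-combination-shifted 2∣s sS∈Z₂ x∈Z₂ i =
    subst Z₂ (sym (combination-shifted i)) (Z₂-* {1/ K′} 1/K′∈Z₂ x+sS∈Z₂)
    where
    1/K′∈Z₂ : Z₂ (1/ K′)
    1/K′∈Z₂ = Z₂-inverse-odd {1/ K′} {K} (2∤suc (∣-trans 2∣s (n∣m*n k))) (ℚP.*-inverseˡ K′)
    x+sS∈Z₂ : Z₂ (combination p c i + s′ * ∑ k (λ l → p l i))
    x+sS∈Z₂ = Z₂-+ {combination p c i} (x∈Z₂ i) (sS∈Z₂ i)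

Z₂-convexCombination : ∀ {d k} (p : Fin k → Point d) (c : Fin k → ℚ) → ∑ k c ≡ 1ℚ →
                       Z₂Point d (combination p c) →
                       Σ (Fin k → ℚ) λ μ → (∀ l → 0ℚ ≤ μ l) × ∑ k μ ≡ 1ℚ × Z₂Point d (combination p μ)
Z₂-convexCombination {d} {k} p c ∑c≡1 x∈Z₂ =
  shifted , shifted-nonNeg -c≤s′ , ∑-shifted ∑c≡1 , Z₂-combination-shifted 2∣s s′S∈Z₂ x∈Z₂
  where
  S : Point d
  S i = ∑ k (λ l → p l i)

  D : ℕ
  D = denominators d S

  N : ℕ
  N = proj₁ (ℕ-uniformUpperBound k (-_ ∘ c))

  s : ℕ
  s = 2 ℕ.* N ℕ.* D

  open ShiftedWeights p c s

  2∣s : 2 ∣ s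
  2∣s = ∣-trans (m∣m*n N) (m∣m*n D)

  -c≤s′ : ∀ l → - c l ≤ s′
  -c≤s′ l = ℚP.≤-trans (proj₂ (ℕ-uniformUpperBound k (-_ ∘ c)) l) (ℤ→ℚ-pos-mono-≤ N≤s)
    where
    N≤s : N ℕ.≤ s
    N≤s = ℕP.≤-trans (ℕP.m≤n*m N 2) (ℕP.m≤m*n (2 ℕ.* N) D {{denominators-nonZero d S}})

  s′S∈Z₂ : ∀ i → Z₂ (s′ * S i)
  s′S∈Z₂ i with *-denominators-integral d S i
  ... | z , SD≡z = subst Z₂ 2Nz≡s′S (Z₂-* {ℤ→ℚ (+ (2 ℕ.* N))} (Z₂-ℤ (+ (2 ℕ.* N))) (Z₂-ℤ z))
    where
    open ≡-Reasoning
    2N D′ : ℚ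
    2N = ℤ→ℚ (+ (2 ℕ.* N))
    D′ = ℤ→ℚ (+ D)
    2Nz≡s′S : 2N * ℤ→ℚ z ≡ s′ * S i
    2Nz≡s′S = begin
      2N * ℤ→ℚ z       ≡⟨ cong (2N *_) (sym SD≡z) ⟩
      2N * (S i * D′)  ≡⟨ solve 3 (λ a x b → a :* (x :* b) := a :* b :* x) refl 2N (S i) D′ ⟩
      2N * D′ * S i    ≡⟨ cong (_* S i) (sym (ℤ→ℚ-pos-* (2 ℕ.* N) D)) ⟩
      s′ * S i         ∎

InP⇒InAff : ∀ {m d} A B {x} → InP m d A B x → InAff m d A B x
InP⇒InAff A B {x} x∈P =
  1 , (λ _ → x) , (λ _ → 1ℚ) , (λ _ → x∈P) , ℚP.+-identityʳ 1ℚ ,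
  (λ i → sym (trans (ℚP.+-identityʳ _) (ℚP.*-identityˡ (x i))))

InAff∩Z₂⇒InP∩Z₂ : ∀ {m d} A B {x} → InAff m d A B x → Z₂Point d x →
                  Σ (Point d) λ y → InP m d A B y × Z₂Point d y
InAff∩Z₂⇒InP∩Z₂ A B (k , p , c , p∈P , ∑c≡1 , x≡pc) x∈Z₂
  = let μ , 0≤μ , ∑μ≡1 , y∈Z₂ = Z₂-convexCombination p c ∑c≡1 (λ i → subst Z₂ (x≡pc i) (x∈Z₂ i))
    in combination p μ , InP-convex A B p μ p∈P 0≤μ ∑μ≡1 , y∈Z₂

mainTheorem3 : (d m : ℕ) (A : Fin m → Fin d → ℤ) (B : Fin m → ℤ) →
    Bounded m d A B →
    ((Σ (Point d) λ x → InP m d A B x × Z₂Point d x)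
      ⇔ (Σ (Point d) λ x → InAff m d A B x × Z₂Point d x))
mainTheorem3 d m A B _ = mk⇔
  (λ (x , x∈P , x∈Z₂) → x , InP⇒InAff A B x∈P , x∈Z₂)
  (λ (x , x∈Aff , x∈Z₂) → InAff∩Z₂⇒InP∩Z₂ A B x∈Aff x∈Z₂)
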